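{- Assume that the HDA $Q$ has non-repeating events. Then for every rooted path $\pi$ ending at a cell $q\in Q_n$, $S_\pi\setminus T_\pi=\{\lambda_1(q),\dots,\lambda_n(q)\}$.
   Context: Precubical sets: families of disjoint sets $Q_n$ with face maps $s_k,t_k:Q_n\to Q_{n-1}$ ($k=1,\dots,n$) satisfying $\alpha_k\beta_\ell=\beta_{\ell-1}\alpha_k$ for $\alpha,\beta\in\{s,t\}$, $k<\ell$. An HDA is a finite precubical set with initial cell $I\in Q_0$. A step is $q'\xrightarrow{s_i}q$ with $s_iq=q'$, or $q\xrightarrow{t_i}q'$ with $t_iq=q'$; a path is a sequence of consecutive steps; rooted paths start at $I$. Universal labels: $\approx$ is the equivalence on $Q_1$ generated by $(s_iq,t_iq)$, $q\in Q_2$, $i\in\{1,2\}$; $\mathcal U(Q)=Q_1/\approx$, $\lambda(e)$ the class of $e$; for $q\in Q_n$, $\lambda_i(q)=\lambda(s_1\cdots s_{i-1}s_{i+1}\cdots s_n(q))$. A sequential path is $v_0\xrightarrow{s}e_1\xrightarrow{t}v_1\cdots\xrightarrow{s}e_n\xrightarrow{t}v_n$ with $v_j\in Q_0$, $e_j\in Q_1$; $Q$ has non-repeating events if on every sequential path $\lambda(e_1),\dots,\lambda(e_n)$ are pairwise distinct. For a rooted path $\pi$ define $(S_\pi,T_\pi)$: trivial path at $I$ gives $(\emptyset,\emptyset)$; $\pi=\pi'\xrightarrow{s_i}q$ gives $S_\pi=S_{\pi'}\cup\{\lambda_i(q)\}$, $T_\pi=T_{\pi'}$; $\pi=\pi'\xrightarrow{t_i}t_i(q')$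 with $q'$ the end of $\pi'$ gives $S_\pi=S_{\pi'}$, $T_\pi=T_{\pi'}\cup\{\lambda_i(q')\}$. -}

module Defs where

open import Data.Nat using (ℕ; zero; suc; _≤_; _<ᵇ_)
open import Data.Fin using (Fin; toℕ; fromℕ; inject₁) renaming (_≤_ to _≤F_)
open import Data.Bool using (if_then_else_)
open import Data.Unit using (⊤)
open import Data.Product using (Σ; ∃; _×_)
open import Data.List using (List; []; _∷_)
open import Data.List.Relation.Unary.Any using (Any)
open import Data.List.Relation.Unary.AllPairs using (AllPairs)
open import Relation.Nullary using (¬_)
open import Relation.Binary.PropositionalEquality using (_≡_)
open import Relation.Binary.Construct.Closure.Equivalence using (EqClosure)
open import Function.Bundles using (_↔_)

-- Cells of dimension n form the type Cell n (so the
-- families Q_n are disjoint by construction).  Face maps are 0-indexed: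
-- the paper's s_k (k = 1..n) on Q_n is  s (k-1)  here.
-- Precubical identity  α_k β_ℓ = β_{ℓ-1} α_k  for k < ℓ (1-indexed) reads,
-- 0-indexed with ℓ0 = suc ℓ and k0 = inject₁ k, k ≤ ℓ:
--   α k (β (suc ℓ) q) ≡ β ℓ (α (inject₁ k) q).
record PrecubicalSet : Set₁ where
  field
    Cell : ℕ → Set
    s t  : ∀ {n} → Fin (suc n) → Cell (suc n) → Cell n
    ss : ∀ {n} (k ℓ : Fin (suc n)) → k ≤F ℓ → (q : Cell (suc (suc n))) →
         s k (s (Fin.suc ℓ) q) ≡ s ℓ (s (inject₁ k) q)
    st : ∀ {n} (k ℓ : Fin (suc n)) → k ≤F ℓ → (q : Cell (suc (suc n))) →
         s k (t (Fin.suc ℓ) q) ≡ t ℓ (s (inject₁ k) q)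
    ts : ∀ {n} (k ℓ : Fin (suc n)) → k ≤F ℓ → (q : Cell (suc (suc n))) →
         t k (s (Fin.suc ℓ) q) ≡ s ℓ (t (inject₁ k) q)
    tt : ∀ {n} (k ℓ : Fin (suc n)) → k ≤F ℓ → (q : Cell (suc (suc n))) →
         t k (t (Fin.suc ℓ) q) ≡ t ℓ (t (inject₁ k) q)

record HDA : Set₁ where
  field
    pcs : PrecubicalSet
  open PrecubicalSet pcs public
  field
    finiteCells : ∀ n → ∃ λ (k : ℕ) → Cell n ↔ Fin k
    finiteDim   : ∃ λ (N : ℕ) → ∀ n → N ≤ n → ¬ Cell n
    I : Cell 0

module _ (Q : HDA) where
  open HDA Q

  data RPath : (n : ℕ) → Cell n → Set where
    start : RPath 0 I
    up    : ∀ {n} (i : Fin (suc n)) (q : Cell (suc n)) → RPath n (s i q) → RPath (suc n) q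
    down  : ∀ {n} (i : Fin (suc n)) (q : Cell (suc n)) → RPath (suc n) q → RPath n (t i q)

  data Gen : Cell 1 → Cell 1 → Set where
    gen : (i : Fin 2) (q : Cell 2) → Gen (s i q) (t i q)

  -- e ≈ e' : equivalence generated by Gen; λ(e) = λ(e') iff e ≈ e'
  _≈_ : Cell 1 → Cell 1 → Set
  _≈_ = EqClosure Gen

  -- removes coordinates j, j-1, ..., 1 (0-indexed), i.e. repeatedly the second-to-last
  front : (j : ℕ) → Cell (suc j) → Cell 1
  front zero q = q
  front (suc j) q = front j (s (inject₁ (fromℕ j)) q)

  -- for q ∈ Q_{n+1} and 0-indexed i: s_1⋯s_{i-1}s_{i+1}⋯s_{n+1}(q) (1-indexed),
  -- applying the rightmost face map first
  edgeAux : (n : ℕ) → ℕ → Cell (suc n) → Cell 1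
  edgeAux zero i q = q
  edgeAux (suc n) i q = if i <ᵇ suc n then edgeAux n i (s (fromℕ (suc n)) q) else front (suc n) q

  -- edge i q: the 1-cell whose class is λ_{i+1}(q)
  edge : ∀ {n} → Fin n → Cell n → Cell 1
  edge {suc n} i q = edgeAux n (toℕ i) q

  -- representatives of the labels in S_π and T_π
  Sreps : ∀ {n q} → RPath n q → List (Cell 1)
  Sreps start = []
  Sreps (up i q π) = edge i q ∷ Sreps π
  Sreps (down i q π) = Sreps π

  Treps : ∀ {n q} → RPath n q → List (Cell 1)
  Treps start = []
  Treps (up i q π) = Treps π
  Treps (down i q π) = edge i q ∷ Treps π

  _∈S_ : Cell 1 → ∀ {n q} → RPath n q → Set
  e ∈S π = Any (e ≈_) (Sreps π)

  _∈T_ : Cell 1 → ∀ {n q} → RPath n q → Set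
  e ∈T π = Any (e ≈_) (Treps π)

  -- sequential paths, given by their list of edges e_1..e_n with t_1 e_j = s_1 e_{j+1}
  -- (the vertices v_j are determined by the edges; n = 0 is the trivial case)
  Sequential : List (Cell 1) → Set
  Sequential [] = ⊤
  Sequential (e ∷ []) = ⊤
  Sequential (e ∷ e′ ∷ es) = (t Fin.zero e ≡ s Fin.zero e′) × Sequential (e′ ∷ es)

  NonRepeating : Set
  NonRepeating = ∀ (es : List (Cell 1)) → Sequential es → AllPairs (λ a b → ¬ (a ≈ b)) es

module Submission where

-- The proof follows the path π and maintains three facts, each proved by
-- induction on π:
--   (a) every label of q lies in S_π                       (edges⊆S);
--   (b) every label of S_π lies in T_π or is a label of q   (S⊆T∪edges);
--   (c) T_π is realised by a sequential path ending at the bottom vertex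
--       of q, the vertex reached from q by lower faces only (sequentialise).
-- Direction ⇒ is (b).  For ⇐, (a) gives membership in S_π, and appending the
-- edge of q that carries the label to the path of (c) yields a sequential
-- path; non-repetition then forbids the label from also lying in T_π.
-- All three inductions rest on how the labels of a cell relate to those of
-- its faces: λ_j(s_i q) = λ_{j'}(q) and λ_j(t_i q) = λ_{j'}(q) with j' the
-- index j shifted past i.

open import Defs
open import Data.Nat using (ℕ; zero; suc; _<ᵇ_; z≤n; s≤s)
open import Data.Fin using (Fin; zero; suc; toℕ; fromℕ; inject₁; punchIn; punchOut; _≟_)
open import Data.Fin.Properties using (punchIn-punchOut; toℕ-inject₁; toℕ-fromℕ)
open import Data.Bool using (true; false)
open import Data.Unit using () renaming (tt to ⋆)
open import Data.Empty using (⊥-elim)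
open import Data.Sum using (_⊎_; inj₁; inj₂)
open import Data.Product using (∃; _×_; _,_)
open import Data.List using (List; []; _∷_; _++_; [_])
open import Data.List.Relation.Unary.Any using (Any; here; there)
import Data.List.Relation.Unary.Any as Any
import Data.List.Relation.Unary.Any.Properties as Any
import Data.List.Relation.Unary.All.Properties as All
open import Data.List.Relation.Unary.All using (_∷_)
open import Data.List.Relation.Unary.AllPairs using (AllPairs; _∷_)
open import Relation.Nullary using (¬_; yes; no)
open import Relation.Binary.PropositionalEquality using (_≡_; refl; sym; trans; cong; subst)
import Relation.Binary.Construct.Closure.Equivalence as EqClosure
open import Relation.Binary.Construct.Closure.Symmetric using (bwd)
open import Relation.Binary.Construct.Closure.ReflexiveTransitive using (ε; _◅_)
open import Function.Bundles using (_⇔_; mk⇔)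

module _ (Q : HDA) where
  open HDA Q

  _∼_ : Cell 1 → Cell 1 → Set
  _∼_ = _≈_ Q

  ∼-sym : ∀ {a b} → a ∼ b → b ∼ a
  ∼-sym = EqClosure.symmetric (Gen Q)

  ∼-trans : ∀ {a b c} → a ∼ b → b ∼ c → a ∼ c
  ∼-trans = EqClosure.transitive (Gen Q)

  ≡⇒∼ : ∀ {a b} → a ≡ b → a ∼ b
  ≡⇒∼ refl = ε

  bottom : ∀ {m} → Cell m → Cell 0
  bottom {zero} q = q
  bottom {suc m} q = bottom (s zero q)

  -- The i-th axis of a cube q: collapse every other coordinate by a lower
  -- face, always removing the lowest coordinate different from i.
  axis : ∀ {m} → Fin (suc m) → Cell (suc m) → Cell 1
  axis {zero} zero q = q
  axis {suc m} zero q = axis zero (s (suc zero) q)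
  axis {suc m} (suc i) q = axis i (s zero q)

  axis-s : ∀ {m} (i : Fin (suc m)) (k : Fin (suc (suc m))) (q : Cell (suc (suc m))) →
           axis i (s k q) ≡ axis (punchIn k i) q
  axis-s i zero q = refl
  axis-s {zero} zero (suc zero) q = refl
  axis-s {suc m} zero (suc zero) q = refl
  axis-s {suc m} zero (suc (suc k)) q =
    trans (cong (axis zero) (ss (suc zero) (suc k) (s≤s z≤n) q)) (axis-s zero (suc k) (s (suc zero) q))
  axis-s {suc m} (suc i) (suc k) q =
    trans (cong (axis i) (ss zero k z≤n q)) (axis-s i k (s zero q))

  axis-resp : ∀ {m} (i : Fin (suc m)) {x x′ y y′ : Cell (suc m)} →
              x ≡ x′ → y ≡ y′ → axis i x′ ∼ axis i y′ → axis i x ∼ axis i y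
  axis-resp i refl refl p = p

  -- Opposite faces have the same axes up to ∼: each axis of t_k q is linked
  -- to the corresponding axis of s_k q through a 2-cell of q.
  axis-t∼axis-s : ∀ {m} (i : Fin (suc m)) (k : Fin (suc (suc m))) (q : Cell (suc (suc m))) →
                  axis i (t k q) ∼ axis i (s k q)
  axis-t∼axis-s {zero} zero k q = bwd (gen k q) ◅ ε
  axis-t∼axis-s {suc m} zero zero q =
    axis-resp zero (sym (ts zero (suc zero) z≤n q)) (sym (ss zero (suc zero) z≤n q))
      (axis-t∼axis-s zero zero (s (suc (suc zero)) q))
  axis-t∼axis-s {suc m} zero (suc zero) q =
    axis-resp zero (sym (ts (suc zero) (suc zero) (s≤s z≤n) q)) (sym (ss (suc zero) (suc zero) (s≤s z≤n) q))
      (axis-t∼axis-s zero (suc zero) (s (suc (suc zero)) q))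
  axis-t∼axis-s {suc m} zero (suc (suc k)) q =
    axis-resp zero (st (suc zero) (suc k) (s≤s z≤n) q) (ss (suc zero) (suc k) (s≤s z≤n) q)
      (axis-t∼axis-s zero (suc k) (s (suc zero) q))
  axis-t∼axis-s {suc m} (suc i) zero q =
    axis-resp i (sym (ts zero zero z≤n q)) (sym (ss zero zero z≤n q))
      (axis-t∼axis-s i zero (s (suc zero) q))
  axis-t∼axis-s {suc m} (suc i) (suc k) q =
    axis-resp i (st zero k z≤n q) (ss zero k z≤n q) (axis-t∼axis-s i k (s zero q))

  bottom-s : ∀ {m} (k : Fin (suc m)) (q : Cell (suc m)) → bottom (s k q) ≡ bottom q
  bottom-s zero q = refl
  bottom-s {suc m} (suc k) q = trans (cong bottom (ss zero k z≤n q)) (bottom-s k (s zero q))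

  source-axis : ∀ {m} (i : Fin (suc m)) (q : Cell (suc m)) → s zero (axis i q) ≡ bottom q
  source-axis {zero} zero q = refl
  source-axis {suc m} zero q = trans (source-axis zero (s (suc zero) q)) (bottom-s (suc zero) q)
  source-axis {suc m} (suc i) q = source-axis i (s zero q)

  target-axis : ∀ {m} (i : Fin (suc m)) (q : Cell (suc m)) → t zero (axis i q) ≡ bottom (t i q)
  target-axis {zero} zero q = refl
  target-axis {suc m} zero q =
    trans (target-axis zero (s (suc zero) q)) (cong bottom (ts zero zero z≤n q))
  target-axis {suc m} (suc i) q =
    trans (target-axis i (s zero q)) (cong bottom (sym (st zero i z≤n q)))

  data LastView {m : ℕ} : Fin (suc m) → Set where
    last : LastView (fromℕ m)
    inner : (j : Fin m) → LastView (inject₁ j)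

  lastView : ∀ {m} (i : Fin (suc m)) → LastView i
  lastView {zero} zero = last
  lastView {suc m} zero = inner zero
  lastView {suc m} (suc i) with lastView i
  ... | last = last
  ... | inner j = inner (suc j)

  punchIn-last : ∀ {m} (j : Fin m) → punchIn (fromℕ m) j ≡ inject₁ j
  punchIn-last zero = refl
  punchIn-last (suc j) = cong suc (punchIn-last j)

  punchIn-below-last : ∀ j → punchIn (inject₁ (fromℕ j)) (fromℕ j) ≡ fromℕ (suc j)
  punchIn-below-last zero = refl
  punchIn-below-last (suc j) = cong suc (punchIn-below-last j)

  inner<ᵇ : ∀ {m} (j : Fin m) → (toℕ j <ᵇ m) ≡ true
  inner<ᵇ zero = refl
  inner<ᵇ (suc j) = inner<ᵇ j

  n<ᵇn : ∀ m → (m <ᵇ m) ≡ false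
  n<ᵇn zero = refl
  n<ᵇn (suc m) = n<ᵇn m

  front≡axis : ∀ j (q : Cell (suc j)) → front Q j q ≡ axis (fromℕ j) q
  front≡axis zero q = refl
  front≡axis (suc j) q =
    trans (front≡axis j _)
      (trans (axis-s (fromℕ j) (inject₁ (fromℕ j)) q) (cong (λ x → axis x q) (punchIn-below-last j)))

  edgeAux≡axis : ∀ m (i : Fin (suc m)) (q : Cell (suc m)) → edgeAux Q m (toℕ i) q ≡ axis i q
  edgeAux≡axis zero zero q = refl
  edgeAux≡axis (suc m) i q with lastView i
  ... | inner j rewrite toℕ-inject₁ j | inner<ᵇ j =
    trans (edgeAux≡axis m j _) (trans (axis-s j (fromℕ (suc m)) q) (cong (λ x → axis x q) (punchIn-last j)))
  ... | last rewrite toℕ-fromℕ m | n<ᵇn m = front≡axis (suc m) q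

  edge≡axis : ∀ {m} (i : Fin (suc m)) (q : Cell (suc m)) → edge Q i q ≡ axis i q
  edge≡axis {m} = edgeAux≡axis m

  edge-s : ∀ {n} (i : Fin (suc n)) (j : Fin n) (q : Cell (suc n)) →
           edge Q j (s i q) ≡ edge Q (punchIn i j) q
  edge-s {suc n} i j q =
    trans (edge≡axis j (s i q)) (trans (axis-s j i q) (sym (edge≡axis (punchIn i j) q)))

  edge-t : ∀ {n} (i : Fin (suc n)) (j : Fin n) (q : Cell (suc n)) →
           edge Q j (t i q) ∼ edge Q (punchIn i j) q
  edge-t {suc n} i j q =
    ∼-trans (≡⇒∼ (edge≡axis j (t i q)))
      (∼-trans (axis-t∼axis-s j i q) (≡⇒∼ (trans (axis-s j i q) (sym (edge≡axis (punchIn i j) q)))))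

  source-edge : ∀ {n} (i : Fin n) (q : Cell n) → s zero (edge Q i q) ≡ bottom q
  source-edge {suc n} i q = trans (cong (s zero) (edge≡axis i q)) (source-axis i q)

  target-edge : ∀ {n} (i : Fin (suc n)) (q : Cell (suc n)) → t zero (edge Q i q) ≡ bottom (t i q)
  target-edge i q = trans (cong (t zero) (edge≡axis i q)) (target-axis i q)

  EndsAt : List (Cell 1) → Cell 0 → Set
  EndsAt [] v = I ≡ v
  EndsAt (e ∷ []) v = t zero e ≡ v
  EndsAt (e ∷ e′ ∷ es) v = EndsAt (e′ ∷ es) v

  snoc-sequential : ∀ ρ {v} x → Sequential Q ρ → EndsAt ρ v → s zero x ≡ v →
                    Sequential Q (ρ ++ [ x ])
  snoc-sequential [] x _ _ _ = ⋆
  snoc-sequential (e ∷ []) x _ end src = trans end (sym src) , ⋆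
  snoc-sequential (e ∷ e′ ∷ es) x (link , seq) end src = link , snoc-sequential (e′ ∷ es) x seq end src

  snoc-endsAt : ∀ ρ x → EndsAt (ρ ++ [ x ]) (t zero x)
  snoc-endsAt [] x = refl
  snoc-endsAt (e ∷ []) x = refl
  snoc-endsAt (e ∷ e′ ∷ es) x = snoc-endsAt (e′ ∷ es) x

  edges⊆S : ∀ {n q} (π : RPath Q n q) (j : Fin n) → _∈S_ Q (edge Q j q) π
  edges⊆S (up i q π) j with i ≟ j
  ... | yes refl = here ε
  ... | no i≢j = there (subst (λ x → _∈S_ Q x π)
                   (trans (edge-s i (punchOut i≢j) q) (cong (λ x → edge Q x q) (punchIn-punchOut i≢j)))
                   (edges⊆S π (punchOut i≢j)))
  edges⊆S (down i q π) j = Any.map (∼-trans (edge-t i j q)) (edges⊆S π (punchIn i j))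

  S⊆T∪edges : ∀ {n q} (π : RPath Q n q) (e : Cell 1) → _∈S_ Q e π →
              _∈T_ Q e π ⊎ ∃ λ (j : Fin n) → e ∼ edge Q j q
  S⊆T∪edges (up i q π) e (here e∼) = inj₂ (i , e∼)
  S⊆T∪edges (up i q π) e (there e∈S) with S⊆T∪edges π e e∈S
  ... | inj₁ e∈T = inj₁ e∈T
  ... | inj₂ (j , e∼) = inj₂ (punchIn i j , ∼-trans e∼ (≡⇒∼ (edge-s i j q)))
  S⊆T∪edges (down i q π) e e∈S with S⊆T∪edges π e e∈S
  ... | inj₁ e∈T = inj₁ (there e∈T)
  ... | inj₂ (j , e∼) with i ≟ j
  ...   | yes refl = inj₁ (here e∼)
  ...   | no i≢j = inj₂ (punchOut i≢j , ∼-trans e∼ (∼-trans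
           (≡⇒∼ (cong (λ x → edge Q x q) (sym (punchIn-punchOut i≢j))))
           (∼-sym (edge-t i (punchOut i≢j) q))))

  record SequentialTrace {n q} (π : RPath Q n q) : Set where
    field
      edges : List (Cell 1)
      sequential : Sequential Q edges
      endsAt : EndsAt edges (bottom q)
      T⊆edges : ∀ e → _∈T_ Q e π → Any (e ∼_) edges

  sequentialise : ∀ {n q} (π : RPath Q n q) → SequentialTrace π
  sequentialise start = record { edges = [] ; sequential = ⋆ ; endsAt = refl ; T⊆edges = λ _ () }
  sequentialise (up i q π) = record
    { edges = edges ; sequential = sequential
    ; endsAt = subst (EndsAt edges) (bottom-s i q) endsAt ; T⊆edges = T⊆edges }
    where open SequentialTrace (sequentialise π)
  sequentialise (down i q π) = record
    { edges = edges ++ [ edge Q i q ]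
    ; sequential = snoc-sequential edges (edge Q i q) sequential endsAt (source-edge i q)
    ; endsAt = subst (EndsAt (edges ++ [ edge Q i q ])) (target-edge i q) (snoc-endsAt edges (edge Q i q))
    ; T⊆edges = T⊆edges′ }
    where
      open SequentialTrace (sequentialise π)
      T⊆edges′ : ∀ e → _∈T_ Q e (down i q π) → Any (e ∼_) (edges ++ [ edge Q i q ])
      T⊆edges′ e (here e∼) = Any.++⁺ʳ edges (here e∼)
      T⊆edges′ e (there e∈T) = Any.++⁺ˡ (T⊆edges e e∈T)

  last-label-fresh : ∀ {a x} ρ → AllPairs (λ u v → ¬ (u ∼ v)) (ρ ++ [ x ]) →
                     Any (a ∼_) ρ → ¬ (a ∼ x)
  last-label-fresh (y ∷ ys) (y≁ ∷ _) (here a∼y) a∼x with All.++⁻ʳ ys y≁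
  ... | y≁x ∷ _ = y≁x (∼-trans (∼-sym a∼y) a∼x)
  last-label-fresh (y ∷ ys) (_ ∷ distinct) (there a∈ys) a∼x = last-label-fresh ys distinct a∈ys a∼x

  edges-not-in-T : NonRepeating Q → ∀ {n q} (π : RPath Q n q) (j : Fin n) (e : Cell 1) →
                   e ∼ edge Q j q → ¬ (_∈T_ Q e π)
  edges-not-in-T nonRep {q = q} π j e e∼ e∈T =
    last-label-fresh edges
      (nonRep _ (snoc-sequential edges (edge Q j q) sequential endsAt (source-edge j q)))
      (T⊆edges e e∈T) e∼
    where open SequentialTrace (sequentialise π)

proposition4p12 : (Q : HDA) → NonRepeating Q →
    ∀ {n : ℕ} {q : HDA.Cell Q n} (π : RPath Q n q) (e : HDA.Cell Q 1) →
    ((_∈S_ Q e π × ¬ (_∈T_ Q e π)) ⇔ (∃ λ (i : Fin n) → _≈_ Q e (edge Q i q)))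
proposition4p12 Q nonRep {n} {q} π e = mk⇔ started-not-terminated⇒edge edge⇒started-not-terminated
  where
    Started-not-terminated : Set
    Started-not-terminated = _∈S_ Q e π × ¬ (_∈T_ Q e π)

    IsEdgeLabel : Set
    IsEdgeLabel = ∃ λ (i : Fin n) → _≈_ Q e (edge Q i q)

    started-not-terminated⇒edge : Started-not-terminated → IsEdgeLabel
    started-not-terminated⇒edge (e∈S , e∉T) with S⊆T∪edges Q π e e∈S
    ... | inj₁ e∈T = ⊥-elim (e∉T e∈T)
    ... | inj₂ label = label

    edge⇒started-not-terminated : IsEdgeLabel → Started-not-terminated
    edge⇒started-not-terminated (i , e∼) =
      Any.map (∼-trans Q e∼) (edges⊆S Q π i) , edges-not-in-T Q nonRep π i e e∼
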